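{- Let $\Pi_{\rm odd}$ be the map on $\mathbb{N}=\{1,2,3,\dots\}$ produced by the following procedure. At step $1$ set $\Pi_{\rm odd}(1)=1$. For $m=2,3,4,\dots$ in turn, at step $m$: if $m$ is odd or $\Pi_{\rm odd}(m-\lfloor m/2\rfloor)$ has been assigned at an earlier step, set $\Pi_{\rm odd}(m+\lfloor m/2\rfloor)=m$; otherwise set $\Pi_{\rm odd}(m-\lfloor m/2\rfloor)=m$. Let $n,k\ge1$ be natural numbers. Then: (a) $\Pi_{\rm odd}(n)$ never has type (I); (b) if $n=3k+1$ then $\Pi_{\rm odd}(n)$ has type (III); (c) if $n=3k+2$ then $\Pi_{\rm odd}(n)$ has type (II); (d) if $n=3k$ then $\Pi_{\rm odd}(n)$ has type (II) if $\Pi_{\rm odd}(k)$ has type (II), and $\Pi_{\rm odd}(n)$ has type (IV) if $\Pi_{\rm odd}(k)$ has type (III) or type (IV).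
   Context: The procedure assigns a value $\Pi_{\rm odd}(n)$ to every $n\in\mathbb{N}$. Types: $\Pi_{\rm odd}(n)$ has type (I) if $\Pi_{\rm odd}(n)>n$ and $\Pi_{\rm odd}(n)=2n-1$; type (II) if $\Pi_{\rm odd}(n)>n$ and $\Pi_{\rm odd}(n)=2n$; type (III) if $\Pi_{\rm odd}(n)<n$ and $\Pi_{\rm odd}(n)=(2n+1)/3$; type (IV) if $\Pi_{\rm odd}(n)<n$ and $\Pi_{\rm odd}(n)=2n/3$. -}

module Defs where

open import Data.Nat using (ℕ; zero; suc; _+_; _*_; _∸_; _/_; _<_; _≡ᵇ_; _%_)
open import Data.Bool using (Bool; true; false; if_then_else_; _∨_)
open import Data.List using (List; []; _∷_)
open import Data.Product using (_×_)
open import Relation.Binary.PropositionalEquality using (_≡_)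

elem : ℕ → List ℕ → Bool
elem x []       = false
elem x (y ∷ ys) = (x ≡ᵇ y) ∨ elem x ys

stepPos : ℕ → List ℕ → ℕ
stepPos zero          _    = zero   -- step 0 does not exist (unused)
stepPos (suc zero)    _    = 1
stepPos m@(suc (suc _)) prev =
  if (m % 2 ≡ᵇ 1) ∨ elem (m ∸ m / 2) prev then m + m / 2 else m ∸ m / 2

assigned : ℕ → List ℕ
assigned zero    = []
assigned (suc m) = stepPos (suc m) (assigned m) ∷ assigned m

target : ℕ → ℕ
target zero    = zero
target (suc m) = stepPos (suc m) (assigned m)

search : ℕ → ℕ → ℕ
search n zero    = zero
search n (suc m) = if target (suc m) ≡ᵇ n then suc m else search n m

-- Π_odd(n) = the step m at which position n receives its value m.
-- Step m assigns a position ≥ ⌈m/2⌉, so only steps m ≤ 2n can assign n.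
-- (If several steps assign n, the last one wins; if none, the value is 0.)
Πodd : ℕ → ℕ
Πodd n = search n (2 * n)

TypeI : ℕ → Set
TypeI n = (n < Πodd n) × (Πodd n ≡ 2 * n ∸ 1)

TypeII : ℕ → Set
TypeII n = (n < Πodd n) × (Πodd n ≡ 2 * n)

-- Π(n) = (2n+1)/3 (exact division) written as 3·Π(n) = 2n+1
TypeIII : ℕ → Set
TypeIII n = (Πodd n < n) × (3 * Πodd n ≡ 2 * n + 1)

-- Π(n) = 2n/3 (exact division) written as 3·Π(n) = 2n
TypeIV : ℕ → Set
TypeIV n = (Πodd n < n) × (3 * Πodd n ≡ 2 * n)

module Submission where

-- Write target s for the position assigned at step s, and call
-- position n "taken early" when some step s < 2n assigns it; this is exactly the
-- test "n ∈ assigned (2n ∸ 1)" made by step 2n.  Unfolding the rule of a step gives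
--   target (2i+1) = 3i+1,   target (2i) = 3i if i is taken early, and i otherwise.
-- Hence the steps s < 2n that assign n are of two rigid shapes (odd steps reaching
-- 3i+1, even steps 2i reaching 3i), and comparing residues mod 3 shows there is at
-- most one of them.  Since Πodd n is the last step ≤ 2n assigning n, this yields
--   Πodd n = 2n                if n is not taken early,
--   Πodd n = s < 2n            if the early step s assigns n.
-- Which positions are taken early is then settled by residues: 3k+1 always (step
-- 2k+1), 3k+2 never, and 3k exactly when k is (via step 2k).

open import Defs
open import Data.Nat using (ℕ; zero; suc; _+_; _*_; _∸_; _/_; _%_; _≤_; _<_; _≡ᵇ_; z≤n; s≤s)
open import Data.Nat.Properties
open import Data.Nat.DivMod using ([m+kn]%n≡m%n; m*n%n≡0; m*n/n≡m; +-distrib-/; m<n⇒m%n≡m)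
open import Data.Nat.Tactic.RingSolver using (solve-∀)
open import Data.Bool using (true; false; T; if_then_else_; _∨_)
open import Data.Bool.Properties using (T-∨)
open import Data.Product using (∃; _×_; _,_; proj₁)
open import Data.Sum using (_⊎_; inj₁; inj₂)
open import Data.Empty using (⊥-elim)
open import Function.Bundles using (Equivalence)
open import Relation.Nullary using (¬_; Dec; yes; no)
open import Relation.Nullary.Decidable using (T?)
open import Relation.Binary.PropositionalEquality
  using (_≡_; _≢_; refl; sym; trans; cong; subst)

odd%2 : ∀ i → (1 + 2 * i) % 2 ≡ 1
odd%2 i rewrite *-comm 2 i = [m+kn]%n≡m%n 1 i 2

odd/2 : ∀ i → (1 + 2 * i) / 2 ≡ i
odd/2 i rewrite *-comm 2 i = trans (+-distrib-/ 1 (i * 2) no-carry) (m*n/n≡m i 2)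
  where
  no-carry : 1 % 2 + (i * 2) % 2 < 2
  no-carry = subst (λ r → 1 + r < 2) (sym (m*n%n≡0 i 2)) (s≤s (s≤s z≤n))

even%2 : ∀ i → (2 * i) % 2 ≡ 0
even%2 i rewrite *-comm 2 i = m*n%n≡0 i 2

even/2 : ∀ i → (2 * i) / 2 ≡ i
even/2 i rewrite *-comm 2 i = m*n/n≡m i 2

2i∸i≡i : ∀ i → 2 * i ∸ i ≡ i
2i∸i≡i i = trans (cong (λ j → i + j ∸ i) (+-identityʳ i)) (m+n∸m≡n i i)

residue-unique : ∀ a b r s → r < 3 → s < 3 → 3 * a + r ≡ 3 * b + s → r ≡ s
residue-unique a b r s r<3 s<3 eq = begin
  r                ≡⟨ sym (m<n⇒m%n≡m r<3) ⟩
  r % 3            ≡⟨ sym ([m+kn]%n≡m%n r a 3) ⟩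
  (r + a * 3) % 3  ≡⟨ cong (_% 3) (shuffle a r) ⟩
  (3 * a + r) % 3  ≡⟨ cong (_% 3) eq ⟩
  (3 * b + s) % 3  ≡⟨ cong (_% 3) (sym (shuffle b s)) ⟩
  (s + b * 3) % 3  ≡⟨ [m+kn]%n≡m%n s b 3 ⟩
  s % 3            ≡⟨ m<n⇒m%n≡m s<3 ⟩
  s                ∎
  where
  open Relation.Binary.PropositionalEquality.≡-Reasoning
  shuffle : ∀ a r → r + a * 3 ≡ 3 * a + r
  shuffle = solve-∀

3a≢3b+1 : ∀ a b → 3 * a ≢ 3 * b + 1
3a≢3b+1 a b eq with residue-unique a b 0 1 (s≤s z≤n) (s≤s (s≤s z≤n)) (trans (+-identityʳ (3 * a)) eq)
... | ()

3a≢3b+2 : ∀ a b → 3 * a ≢ 3 * b + 2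
3a≢3b+2 a b eq with residue-unique a b 0 2 (s≤s z≤n) (s≤s (s≤s (s≤s z≤n))) (trans (+-identityʳ (3 * a)) eq)
... | ()

3a+1≢3b+2 : ∀ a b → 3 * a + 1 ≢ 3 * b + 2
3a+1≢3b+2 a b eq with residue-unique a b 1 2 (s≤s (s≤s z≤n)) (s≤s (s≤s (s≤s z≤n))) eq
... | ()

data Mod3 : ℕ → Set where
  res0 : ∀ k → Mod3 (3 * k)
  res1 : ∀ k → Mod3 (3 * k + 1)
  res2 : ∀ k → Mod3 (3 * k + 2)

mod3 : ∀ n → Mod3 n
mod3 zero = res0 0
mod3 (suc n) with mod3 n
... | res0 k = subst Mod3 (+-comm (3 * k) 1) (res1 k)
... | res1 k = subst Mod3 (next k) (res2 k)
  where next : ∀ k → 3 * k + 2 ≡ suc (3 * k + 1)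
        next = solve-∀
... | res2 k = subst Mod3 (next k) (res0 (suc k))
  where next : ∀ k → 3 * suc k ≡ suc (3 * k + 2)
        next = solve-∀

data Parity : ℕ → Set where
  even : ∀ i → Parity (2 * i)
  odd  : ∀ i → Parity (1 + 2 * i)

parity : ∀ t → Parity t
parity zero = even 0
parity (suc t) with parity t
... | even i = odd i
... | odd i  = subst Parity (next i) (even (suc i))
  where next : ∀ i → 2 * suc i ≡ suc (1 + 2 * i)
        next = solve-∀

<⇒≤∸1 : ∀ {s m} → s < m → s ≤ m ∸ 1
<⇒≤∸1 {m = suc m} (s≤s s≤m) = s≤m

≤∸1⇒< : ∀ {s m} → 1 ≤ s → s ≤ m ∸ 1 → s < m
≤∸1⇒< {m = zero}  1≤s s≤0 = ⊥-elim (1+n≰n (≤-trans 1≤s s≤0))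
≤∸1⇒< {m = suc m} _   s≤m = s≤s s≤m

∸1< : ∀ {m} → 1 ≤ m → m ∸ 1 < m
∸1< {suc m} _ = ≤-refl

below-double⇒positive : ∀ {s n} → s < 2 * n → 1 ≤ n
below-double⇒positive {n = suc n} _ = s≤s z≤n

n<2n : ∀ {n} → 1 ≤ n → n < 2 * n
n<2n {n} 1≤n = m<m+n n (≤-trans 1≤n (m≤m+n n 0))

n<3n : ∀ {n} → 1 ≤ n → n < 3 * n
n<3n {n} 1≤n = m<m+n n (≤-trans 1≤n (m≤m+n n _))

stepPos-rule : ∀ m prev → 2 ≤ m → stepPos m prev ≡
  (if (m % 2 ≡ᵇ 1) ∨ elem (m ∸ m / 2) prev then m + m / 2 else m ∸ m / 2)
stepPos-rule (suc (suc m)) prev _        = refl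
stepPos-rule (suc zero)    prev (s≤s ())

stepPos-odd : ∀ i prev → 1 ≤ i → stepPos (1 + 2 * i) prev ≡ 3 * i + 1
stepPos-odd i prev 1≤i rewrite stepPos-rule (1 + 2 * i) prev (s≤s (≤-trans 1≤i (m≤m+n i _))) | odd%2 i | odd/2 i
  = arith i
  where arith : ∀ i → 1 + 2 * i + i ≡ 3 * i + 1
        arith = solve-∀

stepPos-even : ∀ i prev → 1 ≤ i → stepPos (2 * i) prev ≡ (if elem i prev then 3 * i else i)
stepPos-even i prev 1≤i rewrite stepPos-rule (2 * i) prev (*-monoʳ-≤ 2 1≤i) | even%2 i | even/2 i | 2i∸i≡i i
  = cong (λ j → if elem i prev then j else i) (arith i)
  where arith : ∀ i → 2 * i + i ≡ 3 * i
        arith = solve-∀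

TakenEarly : ℕ → Set
TakenEarly n = T (elem n (assigned (2 * n ∸ 1)))

takenEarly? : ∀ n → Dec (TakenEarly n)
takenEarly? n = T? (elem n (assigned (2 * n ∸ 1)))

target-odd : ∀ i → target (1 + 2 * i) ≡ 3 * i + 1
target-odd zero    = refl
target-odd (suc i) = stepPos-odd (suc i) (assigned (2 * suc i)) (s≤s z≤n)

target-even-taken : ∀ i → 1 ≤ i → TakenEarly i → target (2 * i) ≡ 3 * i
target-even-taken (suc i) 1≤i taken
  with elem (suc i) (assigned (2 * suc i ∸ 1)) | stepPos-even (suc i) (assigned (2 * suc i ∸ 1)) 1≤i
... | true  | eq = eq
... | false | _  = ⊥-elim taken

target-even-free : ∀ i → 1 ≤ i → ¬ TakenEarly i → target (2 * i) ≡ i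
target-even-free (suc i) 1≤i free
  with elem (suc i) (assigned (2 * suc i ∸ 1)) | stepPos-even (suc i) (assigned (2 * suc i ∸ 1)) 1≤i
... | true  | _  = ⊥-elim (free _)
... | false | eq = eq

assigned⁺ : ∀ m p s → 1 ≤ s → s ≤ m → target s ≡ p → T (elem p (assigned m))
assigned⁺ zero    _ _ () z≤n _
assigned⁺ (suc m) p s 1≤s s≤m eq with s ≟ suc m
... | yes refl = Equivalence.from T-∨ (inj₁ (≡⇒≡ᵇ p (target (suc m)) (sym eq)))
... | no s≢m   = Equivalence.from T-∨ (inj₂ (assigned⁺ m p s 1≤s (m<1+n⇒m≤n (≤∧≢⇒< s≤m s≢m)) eq))

assigned⁻ : ∀ m p → T (elem p (assigned m)) → ∃ λ s → 1 ≤ s × s ≤ m × target s ≡ p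
assigned⁻ (suc m) p mem with Equivalence.to T-∨ mem
... | inj₁ p≡t = suc m , s≤s z≤n , ≤-refl , sym (≡ᵇ⇒≡ p (target (suc m)) p≡t)
... | inj₂ rest with assigned⁻ m p rest
...   | s , 1≤s , s≤m , eq = s , 1≤s , m≤n⇒m≤1+n s≤m , eq

record EarlyStep (n s : ℕ) : Set where
  constructor early-step
  field
    positive : 1 ≤ s
    early    : s < 2 * n
    hits     : target s ≡ n

early⇒taken : ∀ {n s} → EarlyStep n s → TakenEarly n
early⇒taken {n} {s} (early-step 1≤s s<2n eq) = assigned⁺ (2 * n ∸ 1) n s 1≤s (<⇒≤∸1 s<2n) eq

taken⇒early : ∀ n → TakenEarly n → ∃ (EarlyStep n)
taken⇒early n taken with assigned⁻ (2 * n ∸ 1) n taken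
... | s , 1≤s , s≤ , eq = s , early-step 1≤s (≤∸1⇒< 1≤s s≤) eq

-- The two ways an early step s < 2n can reach n: the fallback step 2n is excluded.
data EarlyShape (s n : ℕ) : Set where
  via-odd  : ∀ i → s ≡ 1 + 2 * i → n ≡ 3 * i + 1 → EarlyShape s n
  via-even : ∀ i → 1 ≤ i → s ≡ 2 * i → TakenEarly i → n ≡ 3 * i → EarlyShape s n

early-shape : ∀ {n s} → EarlyStep n s → EarlyShape s n
early-shape {n} {s} (early-step 1≤s s<2n eq) with parity s
... | odd i  = via-odd i refl (trans (sym eq) (target-odd i))
... | even zero = ⊥-elim (1+n≰n 1≤s)
... | even (suc i) with takenEarly? (suc i)
...   | yes taken = via-even (suc i) (s≤s z≤n) refl taken
                      (trans (sym eq) (target-even-taken (suc i) (s≤s z≤n) taken))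
...   | no free   = ⊥-elim (<-irrefl (cong (2 *_) i≡n) s<2n)
  where i≡n : suc i ≡ n
        i≡n = trans (sym (target-even-free (suc i) (s≤s z≤n) free)) eq

-- At most one early step reaches a given position: the shapes are told apart by
-- the residue of n mod 3, and within a shape n determines the step.
early-unique : ∀ {n s t} → EarlyStep n s → EarlyStep n t → s ≡ t
early-unique es et with early-shape es | early-shape et
... | via-odd i refl n≡ | via-odd j refl n≡'
  = cong (λ x → 1 + 2 * x) (*-cancelˡ-≡ i j 3 (+-cancelʳ-≡ 1 _ _ (trans (sym n≡) n≡')))
... | via-even i _ refl _ n≡ | via-even j _ refl _ n≡'
  = cong (2 *_) (*-cancelˡ-≡ i j 3 (trans (sym n≡) n≡'))
... | via-odd i _ n≡ | via-even j _ _ _ n≡' = ⊥-elim (3a≢3b+1 j i (trans (sym n≡') n≡))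
... | via-even i _ _ _ n≡ | via-odd j _ n≡' = ⊥-elim (3a≢3b+1 i j (trans (sym n≡) n≡'))

search-top : ∀ n m → target (suc m) ≡ n → search n (suc m) ≡ suc m
search-top n m eq with target (suc m) ≡ᵇ n | ≡⇒≡ᵇ (target (suc m)) n eq
... | true | _ = refl

search-skip : ∀ n m → target (suc m) ≢ n → search n (suc m) ≡ search n m
search-skip n m neq with target (suc m) ≡ᵇ n | ≡ᵇ⇒≡ (target (suc m)) n
... | true  | eq = ⊥-elim (neq (eq _))
... | false | _  = refl

search-last : ∀ n M s → 1 ≤ s → s ≤ M → target s ≡ n →
  (∀ t → s < t → t ≤ M → target t ≢ n) → search n M ≡ s
search-last n zero    _ () z≤n _ _
search-last n (suc M) s 1≤s s≤M eq later with s ≟ suc M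
... | yes refl = search-top n M eq
... | no s≢M   = trans (search-skip n M (later (suc M) s<M ≤-refl))
                   (search-last n M s 1≤s (m<1+n⇒m≤n s<M) eq (λ t s<t t≤M → later t s<t (m≤n⇒m≤1+n t≤M)))
  where s<M : s < suc M
        s<M = ≤∧≢⇒< s≤M s≢M

-- If the early step s assigns n, no later step ≤ 2n does:
-- step 2n then goes to 3n, and other early steps coincide with s.

Πodd-free : ∀ n → 1 ≤ n → ¬ TakenEarly n → Πodd n ≡ 2 * n
Πodd-free n 1≤n free = search-last n (2 * n) (2 * n) (≤-trans 1≤n (m≤m+n n _)) ≤-refl
  (target-even-free n 1≤n free) (λ t 2n<t t≤2n _ → <-irrefl refl (<-≤-trans 2n<t t≤2n))

Πodd-early : ∀ {n s} → EarlyStep n s → Πodd n ≡ s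
Πodd-early {n} {s} es@(early-step 1≤s s<2n eq) = search-last n (2 * n) s 1≤s (<⇒≤ s<2n) eq later
  where
  1≤n : 1 ≤ n
  1≤n = below-double⇒positive s<2n
  later : ∀ t → s < t → t ≤ 2 * n → target t ≢ n
  later t s<t t≤2n tgt with m≤n⇒m<n∨m≡n t≤2n
  ... | inj₁ t<2n = <-irrefl (early-unique es (early-step (≤-trans (s≤s z≤n) s<t) t<2n tgt)) s<t
  ... | inj₂ refl = <-irrefl (sym (trans (sym (target-even-taken n 1≤n (early⇒taken es))) tgt)) (n<3n 1≤n)

Πodd-taken-below : ∀ n → TakenEarly n → Πodd n < 2 * n
Πodd-taken-below n taken with taken⇒early n taken
... | s , es = subst (_< 2 * n) (sym (Πodd-early es)) (EarlyStep.early es)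

doubled⇒free : ∀ n → Πodd n ≡ 2 * n → ¬ TakenEarly n
doubled⇒free n eq taken = <-irrefl eq (Πodd-taken-below n taken)

shrunk⇒taken : ∀ n → 1 ≤ n → Πodd n < n → TakenEarly n
shrunk⇒taken n 1≤n shrunk with takenEarly? n
... | yes taken = taken
... | no free   = ⊥-elim (<-asym shrunk (subst (n <_) (sym (Πodd-free n 1≤n free)) (n<2n 1≤n)))

step-for-3k+1 : ∀ k → EarlyStep (3 * k + 1) (1 + 2 * k)
step-for-3k+1 k = early-step (s≤s z≤n) (subst (1 + 2 * k <_) (sym (arith k)) (m<m+n _ (s≤s z≤n))) (target-odd k)
  where arith : ∀ k → 2 * (3 * k + 1) ≡ (1 + 2 * k) + (1 + 4 * k)
        arith = solve-∀

step-for-3k : ∀ k → 1 ≤ k → TakenEarly k → EarlyStep (3 * k) (2 * k)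
step-for-3k k 1≤k taken =
  early-step (≤-trans 1≤k (m≤m+n k _)) (*-monoʳ-< 2 (n<3n 1≤k)) (target-even-taken k 1≤k taken)

3k+2-free : ∀ k → ¬ TakenEarly (3 * k + 2)
3k+2-free k taken with taken⇒early (3 * k + 2) taken
... | _ , es with early-shape es
...   | via-odd i _ n≡      = 3a+1≢3b+2 i k (sym n≡)
...   | via-even i _ _ _ n≡ = 3a≢3b+2 i k (sym n≡)

3k-taken⇒k-taken : ∀ k → TakenEarly (3 * k) → TakenEarly k
3k-taken⇒k-taken k taken with taken⇒early (3 * k) taken
... | _ , es with early-shape es
...   | via-odd i _ n≡ = ⊥-elim (3a≢3b+1 k i n≡)
...   | via-even i _ _ taken-i n≡ = subst TakenEarly (*-cancelˡ-≡ i k 3 (sym n≡)) taken-i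

Πodd-3k+1 : ∀ k → Πodd (3 * k + 1) ≡ 1 + 2 * k
Πodd-3k+1 k = Πodd-early (step-for-3k+1 k)

Πodd-3k+2 : ∀ k → Πodd (3 * k + 2) ≡ 2 * (3 * k + 2)
Πodd-3k+2 k = Πodd-free (3 * k + 2) (≤-trans (s≤s z≤n) (m≤n+m 2 (3 * k))) (3k+2-free k)

Πodd-3k-taken : ∀ k → 1 ≤ k → TakenEarly k → Πodd (3 * k) ≡ 2 * k
Πodd-3k-taken k 1≤k taken = Πodd-early (step-for-3k k 1≤k taken)

Πodd-3k-free : ∀ k → 1 ≤ k → ¬ TakenEarly k → Πodd (3 * k) ≡ 2 * (3 * k)
Πodd-3k-free k 1≤k free =
  Πodd-free (3 * k) (≤-trans 1≤k (m≤m+n k _)) (λ taken → free (3k-taken⇒k-taken k taken))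

doubled⇒TypeII : ∀ n → 1 ≤ n → Πodd n ≡ 2 * n → TypeII n
doubled⇒TypeII n 1≤n eq = subst (n <_) (sym eq) (n<2n 1≤n) , eq

doubled⇒¬TypeI : ∀ n → 1 ≤ n → Πodd n ≡ 2 * n → ¬ TypeI n
doubled⇒¬TypeI n 1≤n eq (_ , eqI) = <-irrefl (sym (trans (sym eq) eqI)) (∸1< (≤-trans 1≤n (m≤m+n n _)))

small⇒¬TypeI : ∀ n → Πodd n ≤ n → ¬ TypeI n
small⇒¬TypeI n small (n<Π , _) = <-irrefl refl (<-≤-trans n<Π small)

3k+1-TypeIII : ∀ k → 1 ≤ k → TypeIII (3 * k + 1)
3k+1-TypeIII k 1≤k rewrite Πodd-3k+1 k = subst (1 + 2 * k <_) (split k) (m<m+n (1 + 2 * k) 1≤k) , triple k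
  where split : ∀ k → 1 + 2 * k + k ≡ 3 * k + 1
        split = solve-∀
        triple : ∀ k → 3 * (1 + 2 * k) ≡ 2 * (3 * k + 1) + 1
        triple = solve-∀

3k-TypeIV : ∀ k → 1 ≤ k → TakenEarly k → TypeIV (3 * k)
3k-TypeIV k 1≤k taken rewrite Πodd-3k-taken k 1≤k taken = subst (2 * k <_) (split k) (m<m+n (2 * k) 1≤k) , triple k
  where split : ∀ k → 2 * k + k ≡ 3 * k
        split = solve-∀
        triple : ∀ k → 3 * (2 * k) ≡ 2 * (3 * k)
        triple = solve-∀

never-TypeI : ∀ n → 1 ≤ n → ¬ TypeI n
never-TypeI n 1≤n with mod3 n
... | res1 k = small⇒¬TypeI n (subst (_≤ 3 * k + 1) (sym (Πodd-3k+1 k)) (subst (1 + 2 * k ≤_) (split k) (m≤m+n _ k)))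
  where split : ∀ k → 1 + 2 * k + k ≡ 3 * k + 1
        split = solve-∀
... | res2 k = doubled⇒¬TypeI n 1≤n (Πodd-3k+2 k)
... | res0 zero = ⊥-elim (1+n≰n 1≤n)
... | res0 k@(suc _) with takenEarly? k
...   | yes taken = small⇒¬TypeI n (<⇒≤ (proj₁ (3k-TypeIV k (s≤s z≤n) taken)))
...   | no free = doubled⇒¬TypeI n 1≤n (Πodd-3k-free k (s≤s z≤n) free)

theorem4 : (n k : ℕ) → 1 ≤ n → 1 ≤ k →
    (¬ TypeI n)
    × (n ≡ 3 * k + 1 → TypeIII n)
    × (n ≡ 3 * k + 2 → TypeII n)
    × (n ≡ 3 * k → (TypeII k → TypeII n) × (TypeIII k ⊎ TypeIV k → TypeIV n))
theorem4 n k 1≤n 1≤k = never-TypeI n 1≤n , part-b , part-c , part-d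
  where
  part-b : n ≡ 3 * k + 1 → TypeIII n
  part-b refl = 3k+1-TypeIII k 1≤k
  part-c : n ≡ 3 * k + 2 → TypeII n
  part-c refl = doubled⇒TypeII n 1≤n (Πodd-3k+2 k)
  -- k of type (II) is not taken early, so 3k is not either; k of type (III)/(IV)
  -- has Πodd k < k, so k is taken early, and then so is 3k via step 2k.
  part-d : n ≡ 3 * k → (TypeII k → TypeII n) × (TypeIII k ⊎ TypeIV k → TypeIV n)
  part-d refl = from-II , from-III-IV
    where
    from-II : TypeII k → TypeII n
    from-II (_ , doubled) = doubled⇒TypeII n 1≤n (Πodd-3k-free k 1≤k (doubled⇒free k doubled))
    from-III-IV : TypeIII k ⊎ TypeIV k → TypeIV n
    from-III-IV (inj₁ (shrunk , _)) = 3k-TypeIV k 1≤k (shrunk⇒taken k 1≤k shrunk)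
    from-III-IV (inj₂ (shrunk , _)) = 3k-TypeIV k 1≤k (shrunk⇒taken k 1≤k shrunk)
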